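{- There exist a set $\Gamma$ of first-order sentences and a first-order sentence $\phi$ such that $\Gamma\mathrel{|\!\sim}\phi$ but there is no sentence $\psi$ of the vocabulary $L_\Gamma\cap L_\phi$ (possibly using equality) with both $\Gamma\mathrel{|\!\sim}\psi$ and $\{\psi\}\mathrel{|\!\sim}\phi$.
   Context: Work in first-order logic with equality (equality is a logical symbol always interpreted as true identity and is available in every vocabulary, including the empty one); function and constant symbols are regarded as predicate symbols, so vocabularies are relational. For a set $\Sigma$ of sentences, $L_\Sigma$ denotes the vocabulary of non-logical symbols occurring in $\Sigma$; $L_{\Gamma,\phi}=L_{\Gamma\cup\{\phi\}}$. For $K$-structures, $\mathfrak{A}\prec_K\mathfrak{B}$ means there is an elementary embedding of $\mathfrak{A}$ into $\mathfrak{B}$ with respect to $K$-formulas. Friendliness: $\Gamma \mathrel{|\!\sim}\phi$ iff for every $L_\Gamma$-structure $\mathfrak{A}\models\Gamma$ there is an $L_\Gamma$-structure $\mathfrak{A}'$ with $\mathfrak{A}\prec_{L_\Gamma}\mathfrak{A}'$ such that $\mathfrak{A}'$ has an expansion (same domain, same interpretation of $L_\Gamma$) to an $L_{\Gamma,\phi}$-structure $\mathfrak{A}''$ with $\mathfrak{A}''\models\phi$. -}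

module Defs where

open import Data.Nat using (ℕ; suc)
open import Data.Fin using (Fin; zero; suc)
open import Data.Vec using (Vec; map)
open import Data.Product using (Σ; _×_; _,_)
open import Data.Sum using (_⊎_)
open import Data.Empty using (⊥)
open import Relation.Nullary using (¬_)
open import Relation.Binary.PropositionalEquality using (_≡_)
open import Function using (_∘_)

record Symbol : Set where
  constructor sym
  field
    name  : ℕ
    arity : ℕ

open Symbol public

Vocabulary : Set₁
Vocabulary = Symbol → Set

-- First-order formulas over relational vocabularies (terms are variables),
-- de Bruijn indexed by the number of free variables.  Equality is logical.
-- Primitive connectives ⊥, ⇒, ∀ (classically complete); ¬, ∨, ∧, ∃ are
-- the usual classical abbreviations.
data Formula (n : ℕ) : Set where
  rel  : (s : Symbol) → Vec (Fin n) (arity s) → Formula n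
  _≐_  : Fin n → Fin n → Formula n
  ⊥'   : Formula n
  _⇒_  : Formula n → Formula n → Formula n
  ∀'   : Formula (suc n) → Formula n

Sentence : Set
Sentence = Formula 0

SentenceSet : Set₁
SentenceSet = Sentence → Set

data Occurs (s : Symbol) : {n : ℕ} → Formula n → Set where
  occ-rel : {n : ℕ} (ts : Vec (Fin n) (arity s)) → Occurs s (rel s ts)
  occ-⇒ˡ  : {n : ℕ} {φ ψ : Formula n} → Occurs s φ → Occurs s (φ ⇒ ψ)
  occ-⇒ʳ  : {n : ℕ} {φ ψ : Formula n} → Occurs s ψ → Occurs s (φ ⇒ ψ)
  occ-∀   : {n : ℕ} {φ : Formula (suc n)} → Occurs s φ → Occurs s (∀' φ)

IsFormulaOf : Vocabulary → {n : ℕ} → Formula n → Set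
IsFormulaOf K φ = (s : Symbol) → Occurs s φ → K s

L : SentenceSet → Vocabulary
L Γ s = Σ Sentence (λ γ → Γ γ × Occurs s γ)

L+ : SentenceSet → Sentence → Vocabulary
L+ Γ φ s = L Γ s ⊎ Occurs s φ

L∩ : SentenceSet → Sentence → Vocabulary
L∩ Γ φ s = L Γ s × Occurs s φ

Singleton : Sentence → SentenceSet
Singleton ψ γ = γ ≡ ψ

-- Interpretations of all symbols on a domain D.  A K-structure is
-- represented by a structure in which only symbols of K matter.
Interpretation : Set → Set₁
Interpretation D = (s : Symbol) → Vec D (arity s) → Set

record Structure : Set₁ where
  constructor mkStructure
  field
    Dom    : Set
    point  : Dom
    interp : Interpretation Dom

open Structure public

extend : {D : Set} {n : ℕ} → D → (Fin n → D) → Fin (suc n) → D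
extend d ρ zero    = d
extend d ρ (suc i) = ρ i

-- Tarskian satisfaction, read classically (atomic truth is ¬¬-stabilised,
-- so every formula's satisfaction is ¬¬-stable: classical semantics).
Sat : (A : Structure) {n : ℕ} → Formula n → (Fin n → Dom A) → Set
Sat A (rel s ts) ρ = ¬ ¬ interp A s (map ρ ts)
Sat A (x ≐ y)    ρ = ¬ ¬ (ρ x ≡ ρ y)
Sat A ⊥'         ρ = ⊥
Sat A (φ ⇒ ψ)    ρ = Sat A φ ρ → Sat A ψ ρ
Sat A (∀' φ)     ρ = (d : Dom A) → Sat A φ (extend d ρ)

empty-assignment : {D : Set} → Fin 0 → D
empty-assignment ()

_⊨_ : Structure → Sentence → Set
A ⊨ φ = Sat A φ empty-assignment

_⊨Set_ : Structure → SentenceSet → Set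
A ⊨Set Γ = (γ : Sentence) → Γ γ → A ⊨ γ

_≺[_]_ : Structure → Vocabulary → Structure → Set
A ≺[ K ] B =
  Σ (Dom A → Dom B) λ f →
    {n : ℕ} (φ : Formula n) → IsFormulaOf K φ → (ρ : Fin n → Dom A) →
      (Sat A φ ρ → Sat B φ (f ∘ ρ)) × (Sat B φ (f ∘ ρ) → Sat A φ ρ)

-- I agrees with the interpretation of A' on the symbols of K
-- (so mkStructure (Dom A') (point A') I is an expansion of the K-reduct of A').
AgreesOn : Vocabulary → (A : Structure) → Interpretation (Dom A) → Set
AgreesOn K A I =
  (s : Symbol) → K s → (v : Vec (Dom A) (arity s)) →
    (I s v → interp A s v) × (interp A s v → I s v)

_|~_ : SentenceSet → Sentence → Set₁
Γ |~ φ =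
  (A : Structure) → A ⊨Set Γ →
    Σ Structure λ A' → (A ≺[ L Γ ] A') ×
      Σ (Interpretation (Dom A')) λ I →
        AgreesOn (L Γ) A' I × (mkStructure (Dom A') (point A') I ⊨ φ)

{-# OPTIONS --safe #-}
-- Take Γ = "R₀ is a strict order without maximum" and φ the same statement about R₁;
-- then Γ |~ φ by interpreting R₁ as R₀. The common vocabulary is empty, so an
-- interpolant ψ is a pure equality sentence. From Γ |~ ψ, ψ holds in (ℕ, <), and since
-- pure equality sentences of quantifier depth m cannot tell an infinite set from one with
-- m + 1 elements, ψ holds in Fin (m + 1). Now {ψ} |~ φ yields a structure satisfying the
-- same equality sentences as Fin (m + 1), hence having at most m + 1 elements, which
-- carries a strict order without maximum: impossible.
module Submission where

open import Defs
open import Data.Empty using (⊥; ⊥-elim)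
open import Data.Fin using (Fin; zero; suc)
import Data.Fin.Properties as Finₚ
open import Data.List using (List; []; _∷_; allFin)
open import Data.List.Membership.Propositional using (_∈_)
open import Data.List.Membership.Propositional.Properties using (∈-allFin)
open import Data.List.Relation.Unary.Any using (here; there)
open import Data.Nat using (ℕ; zero; suc; _+_; _⊔_; _≤_; _<_; s≤s)
import Data.Nat.Properties as ℕₚ
open import Data.Product using (Σ; ∃; _×_; _,_; proj₁; proj₂)
open import Data.Unit using (⊤; tt)
open import Data.Vec using ([]; _∷_)
open import Data.Vec.Properties using (map-cong)
open import Function using (_∘_; id; _⇔_; mk⇔; Equivalence)
open import Function.Properties.Equivalence using () renaming (sym to ⇔-sym)
open import Function.Definitions using (Injective)
open import Relation.Binary.Definitions using (DecidableEquality)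
open import Relation.Binary.PropositionalEquality
  using (_≡_; _≢_; _≗_; refl; trans; cong; subst)
import Relation.Binary.PropositionalEquality as ≡
open import Relation.Nullary using (¬_; yes; no)
open import Relation.Nullary.Negation using (¬¬-map)

open Equivalence using (to; from)

private variable
  D E : Set
  n : ℕ

SymbolFree : Formula n → Set
SymbolFree χ = ∀ s → ¬ Occurs s χ

symbolFree⇒IsFormulaOf : {χ : Formula n} (K : Vocabulary) → SymbolFree χ → IsFormulaOf K χ
symbolFree⇒IsFormulaOf K free s s∈χ = ⊥-elim (free s s∈χ)

extend-cong : (d : D) {ρ ρ' : Fin n → D} → ρ ≗ ρ' → extend d ρ ≗ extend d ρ'
extend-cong d ρ≗ρ' zero    = refl
extend-cong d ρ≗ρ' (suc i) = ρ≗ρ' i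

Sat-cong : (A : Structure) (χ : Formula n) {ρ ρ' : Fin n → Dom A} →
           ρ ≗ ρ' → Sat A χ ρ → Sat A χ ρ'
Sat-cong A (rel s ts) ρ≗ρ' = ¬¬-map (subst (interp A s) (map-cong ρ≗ρ' ts))
Sat-cong A (x ≐ y)    ρ≗ρ' = ¬¬-map (λ ρx≡ρy → trans (≡.sym (ρ≗ρ' x)) (trans ρx≡ρy (ρ≗ρ' y)))
Sat-cong A ⊥'         ρ≗ρ' = id
Sat-cong A (a ⇒ b)    ρ≗ρ' h = Sat-cong A b ρ≗ρ' ∘ h ∘ Sat-cong A a (≡.sym ∘ ρ≗ρ')
Sat-cong A (∀' a)     ρ≗ρ' h d = Sat-cong A a (extend-cong d ρ≗ρ') (h d)

Sat-symbolFree : {p q : D} {I J : Interpretation D} (χ : Formula n) → SymbolFree χ →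
                 (ρ : Fin n → D) → Sat (mkStructure D p I) χ ρ → Sat (mkStructure D q J) χ ρ
Sat-symbolFree (rel s ts) free ρ = ⊥-elim (free s (occ-rel ts))
Sat-symbolFree (x ≐ y)    free ρ = id
Sat-symbolFree ⊥'         free ρ = id
Sat-symbolFree (a ⇒ b)    free ρ h =
  Sat-symbolFree b (λ s → free s ∘ occ-⇒ʳ) ρ ∘ h ∘ Sat-symbolFree a (λ s → free s ∘ occ-⇒ˡ) ρ
Sat-symbolFree (∀' a)     free ρ h d = Sat-symbolFree a (λ s → free s ∘ occ-∀) (extend d ρ) (h d)

≺-refl : {A : Structure} {K : Vocabulary} → A ≺[ K ] A
≺-refl = id , λ _ _ _ → id , id

≺-⊨ : {A B : Structure} {K : Vocabulary} → A ≺[ K ] B →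
      (θ : Sentence) → IsFormulaOf K θ → A ⊨ θ ⇔ B ⊨ θ
≺-⊨ {B = B} (_ , elementary) θ θ∈K = mk⇔
  (Sat-cong B θ (λ ()) ∘ proj₁ (elementary θ θ∈K empty-assignment))
  (proj₂ (elementary θ θ∈K empty-assignment) ∘ Sat-cong B θ (λ ()))

|~-witness : {Γ : SentenceSet} {φ : Sentence} {A : Structure} → Γ |~ φ → A ⊨Set Γ →
             Σ Structure λ C → C ⊨ φ × ((θ : Sentence) → SymbolFree θ → A ⊨ θ ⇔ C ⊨ θ)
|~-witness {Γ} {A = A} Γ|~φ A⊨Γ with Γ|~φ A A⊨Γ
... | A' , A≺A' , I , _ , A'I⊨φ = mkStructure (Dom A') (point A') I , A'I⊨φ , λ θ free →
  let A⇔A' = ≺-⊨ A≺A' θ (symbolFree⇒IsFormulaOf (L Γ) free)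
  in mk⇔ (Sat-symbolFree θ free _ ∘ to A⇔A') (from A⇔A' ∘ Sat-symbolFree θ free _)

quantifierDepth : Formula n → ℕ
quantifierDepth (rel _ _) = 0
quantifierDepth (_ ≐ _)   = 0
quantifierDepth ⊥'        = 0
quantifierDepth (a ⇒ b)   = quantifierDepth a ⊔ quantifierDepth b
quantifierDepth (∀' a)    = suc (quantifierDepth a)

HasFresh : ℕ → Set → Set
HasFresh M D = {n : ℕ} → n < M → (ρ : Fin n → D) → ∃ λ d → ∀ i → ρ i ≢ d

sum : (Fin n → ℕ) → ℕ
sum {zero}  ρ = 0
sum {suc n} ρ = ρ zero + sum (ρ ∘ suc)

≤-sum : (ρ : Fin n → ℕ) (i : Fin n) → ρ i ≤ sum ρ
≤-sum ρ zero    = ℕₚ.m≤m+n (ρ zero) (sum (ρ ∘ suc))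
≤-sum ρ (suc i) = ℕₚ.≤-trans (≤-sum (ρ ∘ suc) i) (ℕₚ.m≤n+m (sum (ρ ∘ suc)) (ρ zero))

ℕ-hasFresh : {M : ℕ} → HasFresh M ℕ
ℕ-hasFresh _ ρ = suc (sum ρ) , λ i ρi≡1+sum → ℕₚ.<-irrefl ρi≡1+sum (s≤s (≤-sum ρ i))

pigeonhole-¬surjective : {M : ℕ} → n < M → (ρ : Fin n → Fin M) → ¬ (∀ e → ∃ λ i → ρ i ≡ e)
pigeonhole-¬surjective n<M ρ onto with Finₚ.pigeonhole n<M (proj₁ ∘ onto)
... | e , e' , e<e' , same-preimage = Finₚ.<⇒≢ e<e'
  (trans (≡.sym (proj₂ (onto e))) (trans (cong ρ same-preimage) (proj₂ (onto e'))))

Fin-hasFresh : {M : ℕ} → HasFresh M (Fin M)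
Fin-hasFresh {M} n<M ρ with Finₚ.¬∀⟶∃¬ M (λ e → ∃ λ i → ρ i ≡ e)
                              (λ e → Finₚ.any? (λ i → ρ i Finₚ.≟ e)) (pigeonhole-¬surjective n<M ρ)
... | e , e∉ρ = e , λ i ρi≡e → e∉ρ (i , ρi≡e)

SameEqualities : (Fin n → D) → (Fin n → E) → Set
SameEqualities ρ σ = ∀ i j → (ρ i ≡ ρ j) ⇔ (σ i ≡ σ j)

Matches : (Fin n → D) → (Fin n → E) → D → E → Set
Matches ρ σ d e = ∀ i → (ρ i ≡ d) ⇔ (σ i ≡ e)

SameEqualities-sym : {ρ : Fin n → D} {σ : Fin n → E} → SameEqualities ρ σ → SameEqualities σ ρ
SameEqualities-sym same i j = ⇔-sym (same i j)

Matches-sym : {ρ : Fin n → D} {σ : Fin n → E} {d : D} {e : E} → Matches ρ σ d e → Matches σ ρ e d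
Matches-sym match i = ⇔-sym (match i)

SameEqualities-extend : {ρ : Fin n → D} {σ : Fin n → E} {d : D} {e : E} →
                        SameEqualities ρ σ → Matches ρ σ d e → SameEqualities (extend d ρ) (extend e σ)
SameEqualities-extend same match zero    zero    = mk⇔ (λ _ → refl) (λ _ → refl)
SameEqualities-extend same match zero    (suc j) =
  mk⇔ (≡.sym ∘ to (match j) ∘ ≡.sym) (≡.sym ∘ from (match j) ∘ ≡.sym)
SameEqualities-extend same match (suc i) zero    = match i
SameEqualities-extend same match (suc i) (suc j) = same i j

matching-point : {M : ℕ} {ρ : Fin n → D} {σ : Fin n → E} → DecidableEquality D → HasFresh M E → n < M →
                 SameEqualities ρ σ → (d : D) → ∃ λ e → Matches ρ σ d e
matching-point {ρ = ρ} {σ} _≟_ fresh n<M same d with Finₚ.any? (λ i → ρ i ≟ d)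
... | yes (i , ρi≡d) = σ i , λ j →
  mk⇔ (λ ρj≡d → to (same j i) (trans ρj≡d (≡.sym ρi≡d))) (λ σj≡σi → trans (from (same j i) σj≡σi) ρi≡d)
... | no d∉ρ = let (e , e∉σ) = fresh n<M σ in e , λ j →
  mk⇔ (λ ρj≡d → ⊥-elim (d∉ρ (j , ρj≡d))) (λ σj≡e → ⊥-elim (e∉σ j σj≡e))

module EqualityGame {M : ℕ} (A B : Structure)
  (_≟ᴬ_ : DecidableEquality (Dom A)) (_≟ᴮ_ : DecidableEquality (Dom B))
  (freshᴬ : HasFresh M (Dom A)) (freshᴮ : HasFresh M (Dom B)) where

  Sat-⇔ : {n : ℕ} (χ : Formula n) → SymbolFree χ → n + quantifierDepth χ ≤ M →
          {ρ : Fin n → Dom A} {σ : Fin n → Dom B} → SameEqualities ρ σ → Sat A χ ρ ⇔ Sat B χ σ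
  Sat-⇔ (rel s ts) free _ _ = ⊥-elim (free s (occ-rel ts))
  Sat-⇔ (x ≐ y)    _    _ same = mk⇔ (¬¬-map (to (same x y))) (¬¬-map (from (same x y)))
  Sat-⇔ ⊥'         _    _ _    = mk⇔ id id
  Sat-⇔ {n} (a ⇒ b) free depth {ρ} {σ} same =
    mk⇔ (λ h → to b⇔ ∘ h ∘ from a⇔) (λ h → from b⇔ ∘ h ∘ to a⇔)
    where
    a⇔ : Sat A a ρ ⇔ Sat B a σ
    a⇔ = Sat-⇔ a (λ s → free s ∘ occ-⇒ˡ)
           (ℕₚ.≤-trans (ℕₚ.+-monoʳ-≤ n (ℕₚ.m≤m⊔n (quantifierDepth a) (quantifierDepth b))) depth) same
    b⇔ : Sat A b ρ ⇔ Sat B b σ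
    b⇔ = Sat-⇔ b (λ s → free s ∘ occ-⇒ʳ)
           (ℕₚ.≤-trans (ℕₚ.+-monoʳ-≤ n (ℕₚ.m≤n⊔m (quantifierDepth a) (quantifierDepth b))) depth) same
  Sat-⇔ {n} (∀' a) free depth {ρ} {σ} same = mk⇔
    (λ h e → let (d , match) = matching-point _≟ᴮ_ freshᴬ n<M (SameEqualities-sym same) e
             in to (a⇔ (SameEqualities-extend same (Matches-sym match))) (h d))
    (λ h d → let (e , match) = matching-point _≟ᴬ_ freshᴮ n<M same d
             in from (a⇔ (SameEqualities-extend same match)) (h e))
    where
    depth' : suc n + quantifierDepth a ≤ M
    depth' = subst (_≤ M) (ℕₚ.+-suc n (quantifierDepth a)) depth
    n<M : n < M
    n<M = ℕₚ.≤-trans (s≤s (ℕₚ.m≤m+n n (quantifierDepth a))) depth'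
    a⇔ : {d : Dom A} {e : Dom B} → SameEqualities (extend d ρ) (extend e σ) →
         Sat A a (extend d ρ) ⇔ Sat B a (extend e σ)
    a⇔ = Sat-⇔ a (λ s → free s ∘ occ-∀) depth'

  ⊨-⇔ : (θ : Sentence) → SymbolFree θ → quantifierDepth θ ≤ M → A ⊨ θ ⇔ B ⊨ θ
  ⊨-⇔ θ free depth = Sat-⇔ θ free depth (λ ())

avoiding : List (Fin n) → Formula (suc n) → Formula (suc n)
avoiding []       ψ = ψ
avoiding (i ∷ is) ψ = ((zero ≐ suc i) ⇒ ⊥') ⇒ avoiding is ψ

-- At an assignment ρ, fewerNewThan k n says that fewer than k elements lie outside the image of ρ.
fewerNewThan : ℕ → (n : ℕ) → Formula n
fewerNewThan zero    n = ⊥'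
fewerNewThan (suc k) n = ∀' (avoiding (allFin n) (fewerNewThan k (suc n)))

fewerThan : ℕ → Sentence
fewerThan k = fewerNewThan k 0

avoiding-symbolFree : (is : List (Fin n)) (ψ : Formula (suc n)) → SymbolFree ψ → SymbolFree (avoiding is ψ)
avoiding-symbolFree []       ψ free = free
avoiding-symbolFree (i ∷ is) ψ free s (occ-⇒ˡ (occ-⇒ˡ ()))
avoiding-symbolFree (i ∷ is) ψ free s (occ-⇒ˡ (occ-⇒ʳ ()))
avoiding-symbolFree (i ∷ is) ψ free s (occ-⇒ʳ s∈ψ) = avoiding-symbolFree is ψ free s s∈ψ

fewerNewThan-symbolFree : (k n : ℕ) → SymbolFree (fewerNewThan k n)
fewerNewThan-symbolFree zero    n s ()
fewerNewThan-symbolFree (suc k) n s (occ-∀ s∈φ) =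
  avoiding-symbolFree (allFin n) _ (fewerNewThan-symbolFree k (suc n)) s s∈φ

avoiding-elim : (C : Structure) (is : List (Fin n)) (ψ : Formula (suc n)) (ρ : Fin (suc n) → Dom C) →
                (∀ i → ρ zero ≢ ρ (suc i)) → Sat C (avoiding is ψ) ρ → Sat C ψ ρ
avoiding-elim C []       ψ ρ new h = h
avoiding-elim C (i ∷ is) ψ ρ new h = avoiding-elim C is ψ ρ new (h (λ ¬¬eq → ¬¬eq (new i)))

avoiding-intro : (C : Structure) (is : List (Fin n)) (ψ : Formula (suc n)) (ρ : Fin (suc n) → Dom C) →
                 ((∀ i → i ∈ is → ρ zero ≢ ρ (suc i)) → Sat C ψ ρ) → Sat C (avoiding is ψ) ρ
avoiding-intro C []       ψ ρ h = h (λ _ ())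
avoiding-intro C (i ∷ is) ψ ρ h new-i = avoiding-intro C is ψ ρ λ new → h λ
  { j (here refl)  eq → new-i (λ ¬eq → ¬eq eq)
  ; j (there j∈is) eq → new j j∈is eq }

extend-injective : {ρ : Fin n → D} {d : D} → Injective _≡_ _≡_ ρ → (∀ i → d ≢ ρ i) →
                   Injective _≡_ _≡_ (extend d ρ)
extend-injective {n = n} {ρ = ρ} {d} ρ-inj new = injective
  where
  injective : {i j : Fin (suc n)} → extend d ρ i ≡ extend d ρ j → i ≡ j
  injective {zero}  {zero}  _  = refl
  injective {zero}  {suc j} eq = ⊥-elim (new j eq)
  injective {suc i} {zero}  eq = ⊥-elim (new i (≡.sym eq))
  injective {suc i} {suc j} eq = cong suc (ρ-inj eq)

fewerNewThan-injection : (C : Structure) {M : ℕ} (f : Dom C → Fin M) → Injective _≡_ _≡_ f →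
                         (k n : ℕ) (ρ : Fin n → Dom C) → Injective _≡_ _≡_ ρ → M < n + k →
                         Sat C (fewerNewThan k n) ρ
fewerNewThan-injection C {M} f f-inj zero n ρ ρ-inj M<n
  with Finₚ.pigeonhole (subst (M <_) (ℕₚ.+-identityʳ n) M<n) (f ∘ ρ)
... | i , j , i<j , eq = Finₚ.<⇒≢ i<j (ρ-inj (f-inj eq))
fewerNewThan-injection C {M} f f-inj (suc k) n ρ ρ-inj M<n+1+k d =
  avoiding-intro C (allFin n) _ (extend d ρ) λ new →
    fewerNewThan-injection C f f-inj k (suc n) (extend d ρ)
      (extend-injective ρ-inj (λ i → new i (∈-allFin i))) (subst (M <_) (ℕₚ.+-suc n k) M<n+1+k)

module UnboundedOrder (C : Structure) (_≺_ : Dom C → Dom C → Set)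
  (≺-irrefl : ∀ x → ¬ x ≺ x) (≺-trans : ∀ {x y z} → x ≺ y → y ≺ z → x ≺ z)
  (≺-unbounded : ∀ x → ¬ (∀ y → ¬ x ≺ y)) where

  ¬fewerNewThan : (k n : ℕ) (ρ : Fin (suc n) → Dom C) → (∀ i → ρ (suc i) ≺ ρ zero) →
                  ¬ Sat C (fewerNewThan k (suc n)) ρ
  ¬fewerNewThan zero    n ρ below-top h = h
  ¬fewerNewThan (suc k) n ρ below-top h = ≺-unbounded (ρ zero) λ d top≺d →
    let below : ∀ i → ρ i ≺ d
        below = λ { zero → top≺d ; (suc i) → ≺-trans (below-top i) top≺d }
    in ¬fewerNewThan k (suc n) (extend d ρ) below
         (avoiding-elim C (allFin (suc n)) _ (extend d ρ)
            (λ i d≡ρi → ≺-irrefl d (subst (_≺ d) (≡.sym d≡ρi) (below i))) (h d))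

  ¬fewerThan : (k : ℕ) → ¬ C ⊨ fewerThan k
  ¬fewerThan zero    h = h
  ¬fewerThan (suc k) h = ¬fewerNewThan k 0 (extend (point C) empty-assignment) (λ ()) (h (point C))

R : ℕ → Symbol
R t = sym t 2

irreflexive transitive serial unboundedStrictOrder : ℕ → Sentence
irreflexive t = ∀' (rel (R t) (zero ∷ zero ∷ []) ⇒ ⊥')
transitive t  = ∀' (∀' (∀' (rel (R t) (suc (suc zero) ∷ suc zero ∷ []) ⇒
                  (rel (R t) (suc zero ∷ zero ∷ []) ⇒ rel (R t) (suc (suc zero) ∷ zero ∷ [])))))
serial t      = ∀' ((∀' (rel (R t) (suc zero ∷ zero ∷ []) ⇒ ⊥')) ⇒ ⊥')
unboundedStrictOrder t = (irreflexive t ⇒ (transitive t ⇒ (serial t ⇒ ⊥'))) ⇒ ⊥'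

⊨unboundedStrictOrder⇒¬fewerThan : (t : ℕ) (C : Structure) → C ⊨ unboundedStrictOrder t →
                                    (k : ℕ) → ¬ C ⊨ fewerThan k
⊨unboundedStrictOrder⇒¬fewerThan t C C⊨order k C⊨fewer = C⊨order λ R-irrefl R-trans R-serial →
  UnboundedOrder.¬fewerThan C (λ x y → ¬ ¬ interp C (R t) (x ∷ y ∷ []))
    R-irrefl (λ {x} {y} {z} → R-trans x y z) R-serial k C⊨fewer

OnlyRel : Symbol → Formula n → Set
OnlyRel r (rel s _) = s ≡ r
OnlyRel r (_ ≐ _)   = ⊤
OnlyRel r ⊥'        = ⊤
OnlyRel r (a ⇒ b)   = OnlyRel r a × OnlyRel r b
OnlyRel r (∀' a)    = OnlyRel r a

OnlyRel-occurs : {r s : Symbol} {χ : Formula n} → OnlyRel r χ → Occurs s χ → s ≡ r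
OnlyRel-occurs s≡r          (occ-rel _)    = s≡r
OnlyRel-occurs (only-a , _) (occ-⇒ˡ s∈a)   = OnlyRel-occurs only-a s∈a
OnlyRel-occurs (_ , only-b) (occ-⇒ʳ s∈b)   = OnlyRel-occurs only-b s∈b
OnlyRel-occurs only-a       (occ-∀ s∈a)    = OnlyRel-occurs only-a s∈a

unboundedStrictOrder-OnlyRel : (t : ℕ) → OnlyRel (R t) (unboundedStrictOrder t)
unboundedStrictOrder-OnlyRel t = (((refl , tt) , (refl , refl , refl) , ((refl , tt) , tt) , tt) , tt)

Γ₀ : SentenceSet
Γ₀ = Singleton (unboundedStrictOrder 0)

φ₀ : Sentence
φ₀ = unboundedStrictOrder 1

L∩Γ₀φ₀-empty : (s : Symbol) → ¬ L∩ Γ₀ φ₀ s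
L∩Γ₀φ₀-empty s ((_ , refl , s∈Γ₀) , s∈φ₀) = ℕₚ.0≢1+n (cong name
  (trans (≡.sym (OnlyRel-occurs (unboundedStrictOrder-OnlyRel 0) s∈Γ₀))
         (OnlyRel-occurs (unboundedStrictOrder-OnlyRel 1) s∈φ₀)))

copyR0toR1 : Interpretation D → Interpretation D
copyR0toR1 I (sym 1 2) = I (R 0)
copyR0toR1 I s         = I s

Γ₀|~φ₀ : Γ₀ |~ φ₀
Γ₀|~φ₀ A A⊨Γ₀ = A , ≺-refl , copyR0toR1 (interp A) , agrees , A⊨Γ₀ _ refl
  where
  agrees : AgreesOn (L Γ₀) A (copyR0toR1 (interp A))
  agrees s (_ , refl , s∈Γ₀) v with OnlyRel-occurs (unboundedStrictOrder-OnlyRel 0) s∈Γ₀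
  ... | refl = id , id

ℕ< : Structure
ℕ< = mkStructure ℕ 0 less
  where
  less : Interpretation ℕ
  less (sym 0 2) (x ∷ y ∷ []) = x < y
  less _         _            = ⊥

ℕ<⊨Γ₀ : ℕ< ⊨Set Γ₀
ℕ<⊨Γ₀ _ refl ¬order = ¬order ¬¬<-irrefl ¬¬<-trans ¬¬<-serial
  where
  ¬¬<-irrefl : (x : ℕ) → ¬ ¬ x < x → ⊥
  ¬¬<-irrefl x ¬¬x<x = ¬¬x<x (ℕₚ.<-irrefl refl)
  ¬¬<-trans : (x y z : ℕ) → ¬ ¬ x < y → ¬ ¬ y < z → ¬ ¬ x < z
  ¬¬<-trans x y z ¬¬x<y ¬¬y<z ¬x<z = ¬¬x<y λ x<y → ¬¬y<z λ y<z → ¬x<z (ℕₚ.<-trans x<y y<z)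
  ¬¬<-serial : (x : ℕ) → ((y : ℕ) → ¬ ¬ x < y → ⊥) → ⊥
  ¬¬<-serial x maximal = maximal (suc x) (λ ¬x<1+x → ¬x<1+x (ℕₚ.n<1+n x))

bareFin : ℕ → Structure
bareFin m = mkStructure (Fin (suc m)) zero (λ _ _ → ⊥)

bareFin⊨fewerThan : (m : ℕ) → bareFin m ⊨ fewerThan (suc (suc m))
bareFin⊨fewerThan m =
  fewerNewThan-injection (bareFin m) id id (suc (suc m)) 0 empty-assignment (λ { {()} }) (ℕₚ.n<1+n (suc m))

ℕ<⇔bareFin : (m : ℕ) (θ : Sentence) → SymbolFree θ → quantifierDepth θ ≤ suc m → ℕ< ⊨ θ ⇔ bareFin m ⊨ θ
ℕ<⇔bareFin m = EqualityGame.⊨-⇔ ℕ< (bareFin m) ℕₚ._≟_ Finₚ._≟_ ℕ-hasFresh Fin-hasFresh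

proposition8 : Σ SentenceSet λ Γ → Σ Sentence λ φ →
    (Γ |~ φ) ×
    ¬ (Σ Sentence λ ψ → IsFormulaOf (L∩ Γ φ) ψ × (Γ |~ ψ) × (Singleton ψ |~ φ))
proposition8 = Γ₀ , φ₀ , Γ₀|~φ₀ , λ (ψ , ψ-common , Γ₀|~ψ , ψ|~φ₀) →
  let free : SymbolFree ψ
      free s = L∩Γ₀φ₀-empty s ∘ ψ-common s
      m = quantifierDepth ψ
      (C₁ , C₁⊨ψ , ℕ<⇔C₁) = |~-witness {φ = ψ} Γ₀|~ψ ℕ<⊨Γ₀
      bareFin⊨ψ = to (ℕ<⇔bareFin m ψ free (ℕₚ.n≤1+n m)) (from (ℕ<⇔C₁ ψ free) C₁⊨ψ)
      (C₂ , C₂⊨φ₀ , bareFin⇔C₂) = |~-witness {φ = φ₀} {A = bareFin m} ψ|~φ₀ (λ { _ refl → bareFin⊨ψ })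
  in ⊨unboundedStrictOrder⇒¬fewerThan 1 C₂ C₂⊨φ₀ (suc (suc m))
       (to (bareFin⇔C₂ (fewerThan (suc (suc m))) (fewerNewThan-symbolFree _ 0)) (bareFin⊨fewerThan m))
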